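{- Let $\lambda\vdash n$, $\mu\vdash n$, $S\in\mathrm{SSYT}(\lambda,\mu)$, $T\in\mathrm{Tab}(\lambda)$, let $C=C(T)$, and let $U$ be any subgroup of $S_n$. Suppose there is an involution $\sigma\mapsto\sigma'$ on the set $UC=\{uc:u\in U,c\in C\}$ such that for each $\sigma\in UC$ there exists $\rho_\sigma\in R(T)$ with $\rho_\sigma^2=1$, $\mathrm{sgn}(\rho_\sigma)=-1$ and $\sigma'=\sigma\rho_\sigma$. Then $\alpha(U)F_T^S=0$, where $\alpha(U)=\sum_{\tau\in U}\mathrm{sgn}(\tau)\tau$.
   Context: $S_n$ acts on $\mathbb{C}[x_1,\ldots,x_n]$ by $\omega\cdot x_i=x_{\omega(i)}$. Tableaux are in French convention. $\mathrm{Tab}(\lambda)$ is the set of fillings of the diagram of $\lambda$ with $1,\ldots,n$ each once; $\mathrm{SSYT}(\lambda,\mu)$ is the set of semistandard tableaux (rows weakly increasing, columns strictly increasing upward) of shape $\lambda$ with $\mu_i$ entries equal to $i$. $C(T)$, $R(T)$ are the subgroups of $S_n$ preserving each column, resp. each row, of $T$ setwise. Cocharge labels: for a standard word (letters $1,\ldots,m$ once each), label $1$ by $0$; if $i$ has label $j$, $i+1$ gets $j$ if it is right of $i$, else $j+1$. For a word $w$ of content $\mu$: $\mathrm{cprev}(m,w_j)$ is the rightmost $m$ strictly left of $w_j$ if one exists, else the rightmost $m$ of $w$; the first standard subword starts at the rightmost $1$ and recursively takes $\mathrm{cprev}(j+1,\cdot)$ of the chosen $j$ for $j<\ell(\mu)$;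 the standard subword decomposition repeatedly extracts first standard subwords from the remaining letters; each letter receives its label within its subword. For $S$, the reading word concatenates rows top to bottom, each left to right, and $\mathrm{cw}_S(s)$ is the label of box $s$. Define $\mathbf{x}_T^S=\prod_s x_{T(s)}^{\mathrm{cw}_S(s)}$ and $F_T^S=\varepsilon_T\cdot\mathbf{x}_T^S$, where $\varepsilon_T=\sum_{\tau\in C(T)}\sum_{\sigma\in R(T)}\mathrm{sgn}(\tau)\tau\sigma$. -}

module Defs where

open import Data.Nat as ℕ using (ℕ; zero; suc; _≤_; _<_; _∸_; _≡ᵇ_; _<ᵇ_; _≤ᵇ_; _⊔_)
open import Data.Bool using (Bool; true; false; if_then_else_; _∧_; _∨_; not)
open import Data.List as L using (List; []; _∷_; _++_; map; concat; concatMap; filterᵇ; length; reverse; upTo; allFin; last; zip; foldr)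
open import Data.Bool.ListAction using (all; any)
open import Data.Nat.ListAction using (sum)
open import Data.List.Relation.Unary.All using (All)
open import Data.List.Relation.Unary.Linked using (Linked)
open import Data.List.Relation.Unary.Unique.Propositional using (Unique)
open import Data.List.Membership.Propositional using (_∈_)
open import Data.Fin as F using (Fin)
open import Data.Vec as V using (Vec)
open import Data.Integer as ℤ using (ℤ; 0ℤ; 1ℤ; -1ℤ)
open import Data.Product using (_×_; _,_; proj₁; proj₂; ∃; ∃₂)
open import Data.Maybe using (Maybe; just; nothing)
open import Relation.Nullary.Decidable using (⌊_⌋)
open import Relation.Binary.PropositionalEquality using (_≡_)

IsPartitionOf : ℕ → List ℕ → Set
IsPartitionOf n la = All (λ k → 1 ≤ k) la × Linked (λ a b → b ≤ a) la × sum la ≡ n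

-- Fillings of Young diagrams (French convention: row 0 is the bottom,
-- longest row; a filling is the list of its rows, bottom to top,
-- each row read left to right).

entry : {A : Set} → List (List A) → ℕ → ℕ → Maybe A
entry rows r c with L.head (L.drop r rows)
... | nothing = nothing
... | just row = L.head (L.drop c row)

shape : {A : Set} → List (List A) → List ℕ
shape = map length

-- T ∈ Tab(λ): filling of the diagram of λ with the letters of Fin n
-- (standing for 1,…,n), each exactly once.
IsTab : (n : ℕ) → List ℕ → List (List (Fin n)) → Set
IsTab n la T = shape T ≡ la × Unique (concat T) × (∀ (i : Fin n) → i ∈ concat T)

countℕ : ℕ → List ℕ → ℕ
countℕ k w = length (filterᵇ (λ x → x ≡ᵇ k) w)

IsSSYT : List ℕ → List ℕ → List (List ℕ) → Set
IsSSYT la mu S =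
  shape S ≡ la
  × (∀ r c x y → entry S r c ≡ just x → entry S r (suc c) ≡ just y → x ≤ y)
  × (∀ r c x y → entry S r c ≡ just x → entry S (suc r) c ≡ just y → x < y)
  × All (λ x → 1 ≤ x × x ≤ length mu) (concat S)
  × (∀ (k : Fin (length mu)) → countℕ (suc (F.toℕ k)) (concat S) ≡ L.lookup mu k)

-- a word is handled as a list of (position , letter)
Item : Set
Item = ℕ × ℕ

positionsOf : ℕ → List Item → List ℕ
positionsOf m ws = map proj₁ (filterᵇ (λ it → proj₂ it ≡ᵇ m) ws)

cprev : ℕ → ℕ → List Item → Maybe ℕ
cprev m p ws with last (map proj₁ (filterᵇ (λ it → (proj₂ it ≡ᵇ m) ∧ (proj₁ it <ᵇ p)) ws))
... | just q = just q
... | nothing = last (positionsOf m ws)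

maxLetter : List Item → ℕ
maxLetter ws = foldr _⊔_ 0 (map proj₂ ws)

chain : ℕ → ℕ → ℕ → ℕ → List Item → List Item
chain zero j p l ws = (p , l) ∷ []
chain (suc s) j p l ws with cprev (suc j) p ws
... | nothing = (p , l) ∷ []
... | just q = (p , l) ∷ chain s (suc j) q (if p <ᵇ q then l else suc l) ws

firstSub : List Item → List Item
firstSub ws with last (positionsOf 1 ws)
... | nothing = []
... | just p = chain (maxLetter ws ∸ 1) 1 p 0 ws

removePositions : List ℕ → List Item → List Item
removePositions ps = filterᵇ (λ it → not (any (λ q → q ≡ᵇ proj₁ it) ps))

-- standard subword decomposition (fuel = length of the word)
decomp : ℕ → List Item → List Item
decomp zero ws = []
decomp (suc f) ws =
  firstSub ws ++ decomp f (removePositions (map proj₁ (firstSub ws)) ws)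

lookupLabel : ℕ → List Item → ℕ
lookupLabel p d with L.head (filterᵇ (λ it → proj₁ it ≡ᵇ p) d)
... | nothing = 0
... | just it = proj₂ it

cocharge : List ℕ → List ℕ
cocharge w = map (λ p → lookupLabel p d) (upTo (length w))
  where d = decomp (length w) (zip (upTo (length w)) w)

splitRows : List ℕ → List ℕ → List (List ℕ)
splitRows [] xs = []
splitRows (k ∷ ks) xs = L.take k xs ∷ splitRows ks (L.drop k xs)

readingWord : List (List ℕ) → List ℕ
readingWord S = concat (reverse S)

cw : List (List ℕ) → List (List ℕ)
cw S = reverse (splitRows (shape (reverse S)) (cocharge (readingWord S)))

-- Permutations of {1,…,n} (as Fin n), stored as the vector of images

Perm : ℕ → Set
Perm n = Vec (Fin n) n

app : {n : ℕ} → Perm n → Fin n → Fin n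
app = V.lookup

_∘ₚ_ : {n : ℕ} → Perm n → Perm n → Perm n
σ ∘ₚ τ = V.tabulate (λ i → app σ (app τ i))

idₚ : {n : ℕ} → Perm n
idₚ = V.tabulate (λ i → i)

_≟ᶠ_ : {n : ℕ} → Fin n → Fin n → Bool
i ≟ᶠ j = ⌊ i F.≟ j ⌋

isPerm : {n : ℕ} → Perm n → Bool
isPerm {n} σ = all (λ i → all (λ j → (i ≟ᶠ j) ∨ not (app σ i ≟ᶠ app σ j)) (allFin n)) (allFin n)

allVecs : (k m : ℕ) → List (Vec (Fin m) k)
allVecs zero m = V.[] ∷ []
allVecs (suc k) m = concatMap (λ x → map (x V.∷_) (allVecs k m)) (allFin m)

allPerms : (n : ℕ) → List (Perm n)
allPerms n = filterᵇ isPerm (allVecs n n)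

inversions : {n : ℕ} → Perm n → ℕ
inversions {n} σ = length (filterᵇ (λ ij → (F.toℕ (proj₁ ij) <ᵇ F.toℕ (proj₂ ij)) ∧ (F.toℕ (app σ (proj₂ ij)) <ᵇ F.toℕ (app σ (proj₁ ij))))
  (concatMap (λ i → map (λ j → (i , j)) (allFin n)) (allFin n)))

sgn : {n : ℕ} → Perm n → ℤ
sgn σ = if (inversions σ ℕ.% 2) ≡ᵇ 0 then 1ℤ else -1ℤ

coords : {A : Set} → List (List A) → List (A × ℕ × ℕ)
coords rows = concat (L.zipWith (λ r row → L.zipWith (λ c x → (x , r , c)) (upTo (length row)) row) (upTo (length rows)) rows)

boxOf : {n : ℕ} → List (List (Fin n)) → Fin n → ℕ × ℕ
boxOf T i with L.head (filterᵇ (λ b → proj₁ b ≟ᶠ i) (coords T))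
... | nothing = (0 , 0)
... | just b = proj₂ b

rowOf colOf : {n : ℕ} → List (List (Fin n)) → Fin n → ℕ
rowOf T i = proj₁ (boxOf T i)
colOf T i = proj₂ (boxOf T i)

inC inR : {n : ℕ} → List (List (Fin n)) → Perm n → Bool
inC {n} T σ = isPerm σ ∧ all (λ i → colOf T (app σ i) ≡ᵇ colOf T i) (allFin n)
inR {n} T σ = isPerm σ ∧ all (λ i → rowOf T (app σ i) ≡ᵇ rowOf T i) (allFin n)

colGroup rowGroup : {n : ℕ} → List (List (Fin n)) → List (Perm n)
colGroup {n} T = filterᵇ (inC T) (allPerms n)
rowGroup {n} T = filterᵇ (inR T) (allPerms n)

-- Polynomials in ℤ[x_1,…,x_n] as formal sums of terms c·x^e

Monomial : ℕ → Set
Monomial n = Fin n → ℕ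

Poly : ℕ → Set
Poly n = List (ℤ × Monomial n)

sumℤ : List ℤ → ℤ
sumℤ = foldr ℤ._+_ 0ℤ

monoEq : {n : ℕ} → Monomial n → Monomial n → Bool
monoEq {n} e f = all (λ i → e i ≡ᵇ f i) (allFin n)

coeff : {n : ℕ} → Poly n → Monomial n → ℤ
coeff p m = sumℤ (map proj₁ (filterᵇ (λ t → monoEq (proj₂ t) m) p))

IsZeroPoly : {n : ℕ} → Poly n → Set
IsZeroPoly {n} p = ∀ (m : Monomial n) → coeff p m ≡ 0ℤ

-- ω · x^e where ω · x_i = x_{ω(i)}
actMono : {n : ℕ} → Perm n → Monomial n → Monomial n
actMono {n} σ e j = sum (map e (filterᵇ (λ i → app σ i ≟ᶠ j) (allFin n)))

-- x_T^S = ∏_s x_{T(s)}^{cw_S(s)}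
xTS : {n : ℕ} → List (List (Fin n)) → List (List ℕ) → Monomial n
xTS T S i with entry (cw S) (rowOf T i) (colOf T i)
... | nothing = 0
... | just k = k

-- α(U) F_T^S = Σ_{τ∈U} Σ_{γ∈C(T)} Σ_{ρ∈R(T)} sgn(τ) sgn(γ) (τγρ)·x_T^S
alphaF : {n : ℕ} → (Perm n → Bool) → List (List (Fin n)) → List (List ℕ) → Poly n
alphaF {n} U T S =
  concatMap (λ τ → concatMap (λ γ → map (λ ρ →
      (sgn τ ℤ.* sgn γ , actMono ((τ ∘ₚ γ) ∘ₚ ρ) (xTS T S)))
    (rowGroup T)) (colGroup T)) (filterᵇ U (allPerms n))

IsSubgroup : {n : ℕ} → (Perm n → Bool) → Set
IsSubgroup {n} U =
  (∀ σ → U σ ≡ true → isPerm σ ≡ true)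
  × U idₚ ≡ true
  × (∀ σ τ → U σ ≡ true → U τ ≡ true → U (σ ∘ₚ τ) ≡ true)
  × (∀ σ → U σ ≡ true → ∃ λ τ → U τ ≡ true × σ ∘ₚ τ ≡ idₚ)

InUC : {n : ℕ} → (Perm n → Bool) → List (List (Fin n)) → Perm n → Set
InUC U T σ = ∃₂ λ u c → U u ≡ true × inC T c ≡ true × σ ≡ u ∘ₚ c

module Submission where

-- Expanding α(U) F_T^S, the coefficient of a monomial m is Σ_{τ∈U} Σ_{γ∈C(T)} w(τγ), where
-- w(σ) = sgn σ · [m] σ·(Σ_{ρ∈R(T)} ρ·x_T^S).  As R(T) is a group, w(σρ) = sgn ρ · w(σ) for ρ ∈ R(T),
-- so the involution σ ↦ σρ_σ on UC negates w.  Translating by elements of U on the left and of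
-- C(T) on the right shows that (τ, γ) ↦ τγ hits every element of UC equally often, so the sum is
-- that multiplicity times Σ_{σ∈UC} w(σ), and the involution cancels it.  Multiplicativity of the
-- sign, defined by counting inversions, comes from counting the pairs reversed by τ and by σ on
-- the image of τ: a pair is reversed by στ iff exactly one of the two reverses it.

open import Defs
open import Data.Nat using (ℕ; zero; suc)
open import Data.Fin using (Fin)
open import Data.List using (List)
open import Data.Bool using (Bool; true)
open import Data.Integer using (-1ℤ)
open import Data.Product using (_×_; ∃)
open import Relation.Binary.PropositionalEquality using (_≡_)

open import Algebra.Bundles using (CommutativeSemigroup)
open import Algebra.Structures using (IsCommutativeMonoid)
open import Level using (0ℓ)
open import Data.List using ([]; _∷_; _++_; map; concatMap; filterᵇ; foldr)
open import Data.List.Membership.Propositional using (_∈_)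
open import Data.List.Membership.Propositional.Properties using (∈-map⁺; ∈-map⁻)
open import Data.List.Membership.Propositional.Properties.WithK using (unique∧set⇒bag)
open import Data.List.Relation.Unary.Any using (here; there)
open import Data.List.Relation.Unary.Unique.Propositional using (Unique)
import Data.List.Relation.Unary.Unique.Propositional.Properties as Unique
open import Data.List.Relation.Binary.Permutation.Propositional using (_↭_; ↭⇒↭ₛ)
import Data.List.Relation.Binary.Permutation.Propositional.Properties as ↭
open import Data.List.Relation.Binary.Permutation.Setoid.Properties using (foldr-commMonoid)
open import Data.List.Relation.Binary.BagAndSetEquality using (∼bag⇒↭)
open import Data.Product using (_,_; proj₁; proj₂)
open import Function using (_∘_)
open import Function.Bundles using (_⇔_; mk⇔)
open import Function.Definitions using (Injective)
open import Relation.Binary.PropositionalEquality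
  using (refl; sym; trans; cong; cong₂; subst; setoid; module ≡-Reasoning)

module _ {A : Set} (p : A → Bool) where

  open import Data.Bool using (T?)
  open import Data.Bool.Properties using (T-≡)
  open import Data.List.Membership.Propositional.Properties using (∈-filter⁺; ∈-filter⁻)
  open import Function.Bundles using (Equivalence)

  filterᵇ-unique : {xs : List A} → Unique xs → Unique (filterᵇ p xs)
  filterᵇ-unique = Unique.filter⁺ (T? ∘ p)

  ∈-filterᵇ⁺ : {xs : List A} {x : A} → x ∈ xs → p x ≡ true → x ∈ filterᵇ p xs
  ∈-filterᵇ⁺ x∈xs px = ∈-filter⁺ (T? ∘ p) x∈xs (Equivalence.from T-≡ px)

  ∈-filterᵇ⁻ : {xs : List A} {x : A} → x ∈ filterᵇ p xs → x ∈ xs × p x ≡ true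
  ∈-filterᵇ⁻ {xs} x∈ = let (x∈xs , px) = ∈-filter⁻ (T? ∘ p) {xs = xs} x∈ in x∈xs , Equivalence.to T-≡ px

module FiniteSums {A : Set} {_+_ : A → A → A} {0# : A}
                  (isCommutativeMonoid : IsCommutativeMonoid _≡_ _+_ 0#) where

  open IsCommutativeMonoid isCommutativeMonoid
    using (assoc; identityˡ; isCommutativeSemigroup)

  commutativeSemigroup : CommutativeSemigroup 0ℓ 0ℓ
  commutativeSemigroup = record { isCommutativeSemigroup = isCommutativeSemigroup }

  open import Algebra.Properties.CommutativeSemigroup commutativeSemigroup using (interchange)

  private variable
    B C : Set

  ∑ : List B → (B → A) → A
  ∑ xs f = foldr _+_ 0# (map f xs)

  syntax ∑ xs (λ x → e) = ∑[ x ∈ xs ] e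

  ∑-map : (φ : B → C) (xs : List B) (f : C → A) → ∑ (map φ xs) f ≡ ∑[ x ∈ xs ] f (φ x)
  ∑-map φ []       f = refl
  ∑-map φ (x ∷ xs) f = cong (f (φ x) +_) (∑-map φ xs f)

  ∑-++ : (xs ys : List B) (f : B → A) → ∑ (xs ++ ys) f ≡ ∑ xs f + ∑ ys f
  ∑-++ []       ys f = sym (identityˡ _)
  ∑-++ (x ∷ xs) ys f = trans (cong (f x +_) (∑-++ xs ys f)) (sym (assoc (f x) _ _))

  ∑-cong : (xs : List B) {f g : B → A} → (∀ {x} → x ∈ xs → f x ≡ g x) → ∑ xs f ≡ ∑ xs g
  ∑-cong []       eq = refl
  ∑-cong (x ∷ xs) eq = cong₂ _+_ (eq (here refl)) (∑-cong xs (eq ∘ there))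

  ∑-zero : (xs : List B) → ∑[ x ∈ xs ] 0# ≡ 0#
  ∑-zero []       = refl
  ∑-zero (x ∷ xs) = trans (identityˡ _) (∑-zero xs)

  ∑-distrib-+ : (xs : List B) (f g : B → A) → ∑[ x ∈ xs ] (f x + g x) ≡ ∑ xs f + ∑ xs g
  ∑-distrib-+ []       f g = sym (identityˡ 0#)
  ∑-distrib-+ (x ∷ xs) f g =
    trans (cong ((f x + g x) +_) (∑-distrib-+ xs f g)) (interchange (f x) (g x) _ _)

  ∑-↭ : {xs ys : List B} (f : B → A) → xs ↭ ys → ∑ xs f ≡ ∑ ys f
  ∑-↭ f p = foldr-commMonoid (setoid A) isCommutativeMonoid (↭⇒↭ₛ (↭.map⁺ f p))

  ∑-reindex : (xs : List B) → Unique xs → (φ : B → B) → Injective _≡_ _≡_ φ →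
              (∀ {x} → x ∈ xs → φ x ∈ xs) → (∀ {y} → y ∈ xs → ∃ λ x → x ∈ xs × φ x ≡ y) →
              (f : B → A) → ∑[ x ∈ xs ] f (φ x) ≡ ∑ xs f
  ∑-reindex xs xs! φ φ-inj into onto f =
    trans (sym (∑-map φ xs f)) (∑-↭ f (∼bag⇒↭ (unique∧set⇒bag (Unique.map⁺ φ-inj xs!) xs! φxs⇔xs)))
    where
    φxs⇔xs : ∀ {y} → y ∈ map φ xs ⇔ y ∈ xs
    φxs⇔xs = mk⇔
      (λ y∈φxs → let (x , x∈xs , y≡φx) = ∈-map⁻ φ y∈φxs in subst (_∈ xs) (sym y≡φx) (into x∈xs))
      (λ y∈xs → let (x , x∈xs , φx≡y) = onto y∈xs in subst (_∈ map φ xs) φx≡y (∈-map⁺ φ x∈xs))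

  ∑-concatMap : (φ : B → List C) (xs : List B) (f : C → A) →
                ∑ (concatMap φ xs) f ≡ ∑[ x ∈ xs ] ∑ (φ x) f
  ∑-concatMap φ []       f = refl
  ∑-concatMap φ (x ∷ xs) f = trans (∑-++ (φ x) _ f) (cong (∑ (φ x) f +_) (∑-concatMap φ xs f))

  ∑-comm : (xs : List B) (ys : List C) (f : B → C → A) →
           ∑[ x ∈ xs ] ∑[ y ∈ ys ] f x y ≡ ∑[ y ∈ ys ] ∑[ x ∈ xs ] f x y
  ∑-comm []       ys f = sym (∑-zero ys)
  ∑-comm (x ∷ xs) ys f =
    trans (cong (∑ ys (f x) +_) (∑-comm xs ys f)) (sym (∑-distrib-+ ys (f x) _))

module IntegerSums where

  open import Data.Bool using (if_then_else_; false)
  open import Data.Empty using (⊥-elim)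
  open import Data.Integer using (ℤ; 0ℤ; 1ℤ; _+_; _*_; -_; +0; +[1+_]; -[1+_]; _≟_)
  import Data.Integer.Properties as ℤ
  open import Data.List.Relation.Unary.All using (lookup)
  open import Data.List.Relation.Unary.Unique.Propositional using (_∷_)
  open import Relation.Binary.Definitions using (DecidableEquality)
  open import Relation.Nullary using (Dec; yes; no; ¬_)

  open FiniteSums ℤ.+-0-isCommutativeMonoid public

  private variable
    B C D : Set

  𝟙 : {P : Set} → Dec P → ℤ
  𝟙 (yes _) = 1ℤ
  𝟙 (no _)  = 0ℤ

  𝟙≢0⇒ : {P : Set} (d : Dec P) → ¬ 𝟙 d ≡ 0ℤ → P
  𝟙≢0⇒ (yes p) _   = p
  𝟙≢0⇒ (no _)  𝟙≢0 = ⊥-elim (𝟙≢0 refl)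

  𝟙-injective : (_≟ᴮ_ : DecidableEquality B) (φ : B → B) → Injective _≡_ _≡_ φ →
                ∀ x y → 𝟙 (φ x ≟ᴮ φ y) ≡ 𝟙 (x ≟ᴮ y)
  𝟙-injective _≟ᴮ_ φ φ-inj x y with φ x ≟ᴮ φ y | x ≟ᴮ y
  ... | yes _     | yes _   = refl
  ... | no _      | no _    = refl
  ... | yes φx≡φy | no x≢y  = ⊥-elim (x≢y (φ-inj φx≡φy))
  ... | no φx≢φy  | yes x≡y = ⊥-elim (φx≢φy (cong φ x≡y))


  ∑-filterᵇ : (p : B → Bool) (xs : List B) (f : B → ℤ) →
              ∑ (filterᵇ p xs) f ≡ ∑[ x ∈ xs ] (if p x then f x else 0ℤ)
  ∑-filterᵇ p []       f = refl
  ∑-filterᵇ p (x ∷ xs) f with p x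
  ... | true  = cong (f x +_) (∑-filterᵇ p xs f)
  ... | false = trans (∑-filterᵇ p xs f) (sym (ℤ.+-identityˡ _))

  ∑-*ˡ : (c : ℤ) (xs : List B) (f : B → ℤ) → ∑[ x ∈ xs ] (c * f x) ≡ c * ∑ xs f
  ∑-*ˡ c []       f = sym (ℤ.*-zeroʳ c)
  ∑-*ˡ c (x ∷ xs) f = trans (cong (c * f x +_) (∑-*ˡ c xs f)) (sym (ℤ.*-distribˡ-+ c (f x) _))

  ∑-*ʳ : (c : ℤ) (xs : List B) (f : B → ℤ) → ∑[ x ∈ xs ] (f x * c) ≡ ∑ xs f * c
  ∑-*ʳ c xs f = trans (∑-cong xs (λ {x} _ → ℤ.*-comm (f x) c))
                      (trans (∑-*ˡ c xs f) (ℤ.*-comm c _))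

  ∑-neg : (xs : List B) (f : B → ℤ) → ∑[ x ∈ xs ] (- f x) ≡ - ∑ xs f
  ∑-neg []       f = refl
  ∑-neg (x ∷ xs) f = trans (cong (- f x +_) (∑-neg xs f)) (sym (ℤ.neg-distrib-+ (f x) _))

  ∑≢0⇒∃≢0 : (xs : List B) (f : B → ℤ) → ¬ ∑ xs f ≡ 0ℤ → ∃ λ x → x ∈ xs × ¬ f x ≡ 0ℤ
  ∑≢0⇒∃≢0 []       f ∑≢0 = ⊥-elim (∑≢0 refl)
  ∑≢0⇒∃≢0 (x ∷ xs) f ∑≢0 with f x ≟ 0ℤ
  ... | no fx≢0 = x , here refl , fx≢0
  ... | yes fx≡0 =
    let (y , y∈xs , fy≢0) = ∑≢0⇒∃≢0 xs f (λ ∑≡0 → ∑≢0 (cong₂ _+_ fx≡0 ∑≡0))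
    in y , there y∈xs , fy≢0

  ∑-𝟙≟ : (_≟ᴮ_ : DecidableEquality B) {xs : List B} → Unique xs → {x : B} → x ∈ xs →
         (g : B → ℤ) → ∑[ y ∈ xs ] (𝟙 (x ≟ᴮ y) * g y) ≡ g x
  ∑-𝟙≟ _≟ᴮ_ {x ∷ xs} (x∉xs ∷ xs!) (here refl) g with x ≟ᴮ x
  ... | no x≢x = ⊥-elim (x≢x refl)
  ... | yes _  = trans (cong₂ _+_ (ℤ.*-identityˡ (g x)) rest) (ℤ.+-identityʳ (g x))
    where
    rest : ∑[ y ∈ xs ] (𝟙 (x ≟ᴮ y) * g y) ≡ 0ℤ
    rest = trans (∑-cong xs λ {y} y∈xs → cong (_* g y) (𝟙-no (λ x≡y → lookup x∉xs y∈xs x≡y)))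
                 (trans (∑-cong xs λ {y} _ → ℤ.*-zeroˡ (g y)) (∑-zero xs))
      where
      𝟙-no : ∀ {y} → ¬ x ≡ y → 𝟙 (x ≟ᴮ y) ≡ 0ℤ
      𝟙-no {y} x≢y with x ≟ᴮ y
      ... | yes x≡y = ⊥-elim (x≢y x≡y)
      ... | no _    = refl
  ∑-𝟙≟ _≟ᴮ_ {y ∷ xs} (y∉xs ∷ xs!) {x} (there x∈xs) g with x ≟ᴮ y
  ... | yes refl = ⊥-elim (lookup y∉xs x∈xs refl)
  ... | no _     = trans (cong₂ _+_ (ℤ.*-zeroˡ (g y)) (∑-𝟙≟ _≟ᴮ_ xs! x∈xs g)) (ℤ.+-identityˡ (g x))

  ∑-antisymmetric-involution :
    {xs : List B} → Unique xs → (ι : B → B) → (∀ x → ι (ι x) ≡ x) → (∀ {x} → x ∈ xs → ι x ∈ xs) →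
    (f : B → ℤ) → (∀ {x} → x ∈ xs → f (ι x) ≡ - f x) → ∑ xs f ≡ 0ℤ
  ∑-antisymmetric-involution {xs = xs} xs! ι ι-involutive ι-into f f∘ι≡-f = i≡-i⇒i≡0 (begin
    ∑ xs f                ≡⟨ ∑-reindex xs xs! ι ι-injective ι-into ι-onto f ⟨
    ∑[ x ∈ xs ] f (ι x)   ≡⟨ ∑-cong xs f∘ι≡-f ⟩
    ∑[ x ∈ xs ] (- f x)   ≡⟨ ∑-neg xs f ⟩
    - ∑ xs f              ∎)
    where
    open ≡-Reasoning
    ι-injective : Injective _≡_ _≡_ ι
    ι-injective {x} {y} ιx≡ιy = trans (sym (ι-involutive x)) (trans (cong ι ιx≡ιy) (ι-involutive y))
    ι-onto : ∀ {y} → y ∈ xs → ∃ λ x → x ∈ xs × ι x ≡ y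
    ι-onto {y} y∈xs = ι y , ι-into y∈xs , ι-involutive y
    i≡-i⇒i≡0 : ∀ {i} → i ≡ - i → i ≡ 0ℤ
    i≡-i⇒i≡0 {+0}       _  = refl
    i≡-i⇒i≡0 {+[1+ _ ]} ()
    i≡-i⇒i≡0 { -[1+ _ ]} ()

  ∑∑-fibres : (_≟ᴰ_ : DecidableEquality D) (φ : B → C → D) (xs : List B) (ys : List C)
              {zs : List D} → Unique zs → (∀ {x y} → x ∈ xs → y ∈ ys → φ x y ∈ zs) → (f : D → ℤ) →
              ∑[ x ∈ xs ] ∑[ y ∈ ys ] f (φ x y) ≡ ∑[ z ∈ zs ] (∑[ x ∈ xs ] ∑[ y ∈ ys ] 𝟙 (φ x y ≟ᴰ z) * f z)
  ∑∑-fibres _≟ᴰ_ φ xs ys {zs} zs! φ∈zs f = begin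
    ∑[ x ∈ xs ] ∑[ y ∈ ys ] f (φ x y)
      ≡⟨ ∑-cong xs (λ x∈ → ∑-cong ys λ y∈ → ∑-𝟙≟ _≟ᴰ_ zs! (φ∈zs x∈ y∈) f) ⟨
    ∑[ x ∈ xs ] ∑[ y ∈ ys ] ∑[ z ∈ zs ] (𝟙 (φ x y ≟ᴰ z) * f z)
      ≡⟨ ∑-cong xs (λ {x} _ → ∑-comm ys zs _) ⟩
    ∑[ x ∈ xs ] ∑[ z ∈ zs ] ∑[ y ∈ ys ] (𝟙 (φ x y ≟ᴰ z) * f z)
      ≡⟨ ∑-comm xs zs _ ⟩
    ∑[ z ∈ zs ] ∑[ x ∈ xs ] ∑[ y ∈ ys ] (𝟙 (φ x y ≟ᴰ z) * f z)
      ≡⟨ ∑-cong zs (λ {z} _ → trans (∑-cong xs λ {x} _ → ∑-*ʳ (f z) ys _) (∑-*ʳ (f z) xs _)) ⟩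
    ∑[ z ∈ zs ] (∑[ x ∈ xs ] ∑[ y ∈ ys ] 𝟙 (φ x y ≟ᴰ z) * f z) ∎
    where open ≡-Reasoning

module Permutations where

  open import Data.Bool using (_∧_; _∨_; not)
  open import Data.Nat using (_≡ᵇ_)
  open import Data.Bool.ListAction using (all)
  open import Data.Bool.Properties using (T-≡)
  open import Data.Empty using (⊥-elim)
  open import Data.Fin as F using (punchOut)
  import Data.Fin.Properties as Fin
  import Data.Nat.Properties as ℕ
  open import Data.List using (allFin; cartesianProductWith)
  open import Data.List.Membership.Propositional.Properties using (∈-allFin; ∈-cartesianProductWith⁺)
  open import Data.List.Relation.Unary.Unique.Propositional using ([]; _∷_)
  import Data.List.Relation.Unary.All as All
  open import Data.List.Relation.Unary.All.Properties using (all⁺; all⁻)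
  open import Data.Vec using (Vec; tabulate) renaming ([] to []ᵥ; _∷_ to _∷ᵥ_)
  import Data.Vec.Properties as Vec
  open import Function.Bundles using (Equivalence)
  open import Relation.Nullary using (yes; no)

  all-allFin⁻ : {n : ℕ} {p : Fin n → Bool} → all p (allFin n) ≡ true → ∀ i → p i ≡ true
  all-allFin⁻ {n} {p} all≡true i =
    Equivalence.to T-≡ (All.lookup (all⁺ p (allFin n) (Equivalence.from T-≡ all≡true)) (∈-allFin i))

  all-allFin⁺ : {n : ℕ} {p : Fin n → Bool} → (∀ i → p i ≡ true) → all p (allFin n) ≡ true
  all-allFin⁺ {n} {p} p≡true =
    Equivalence.to T-≡ (all⁻ p {allFin n} (All.tabulate (λ {i} _ → Equivalence.from T-≡ (p≡true i))))

  module _ {n : ℕ} where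

    app-∘ₚ : (σ τ : Perm n) (i : Fin n) → app (σ ∘ₚ τ) i ≡ app σ (app τ i)
    app-∘ₚ σ τ = Vec.lookup∘tabulate _

    app-idₚ : (i : Fin n) → app idₚ i ≡ i
    app-idₚ = Vec.lookup∘tabulate _

    perm-ext : {σ τ : Perm n} → (∀ i → app σ i ≡ app τ i) → σ ≡ τ
    perm-ext {σ} {τ} σ≗τ =
      trans (sym (Vec.tabulate∘lookup σ)) (trans (Vec.tabulate-cong σ≗τ) (Vec.tabulate∘lookup τ))

    ∘ₚ-assoc : (σ τ υ : Perm n) → (σ ∘ₚ τ) ∘ₚ υ ≡ σ ∘ₚ (τ ∘ₚ υ)
    ∘ₚ-assoc σ τ υ = perm-ext λ i → begin
      app ((σ ∘ₚ τ) ∘ₚ υ) i    ≡⟨ app-∘ₚ (σ ∘ₚ τ) υ i ⟩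
      app (σ ∘ₚ τ) (app υ i)   ≡⟨ app-∘ₚ σ τ _ ⟩
      app σ (app τ (app υ i))  ≡⟨ cong (app σ) (app-∘ₚ τ υ i) ⟨
      app σ (app (τ ∘ₚ υ) i)   ≡⟨ app-∘ₚ σ (τ ∘ₚ υ) i ⟨
      app (σ ∘ₚ (τ ∘ₚ υ)) i    ∎
      where open ≡-Reasoning

    ∘ₚ-identityˡ : (σ : Perm n) → idₚ ∘ₚ σ ≡ σ
    ∘ₚ-identityˡ σ = perm-ext λ i → trans (app-∘ₚ idₚ σ i) (app-idₚ (app σ i))

    ∘ₚ-identityʳ : (σ : Perm n) → σ ∘ₚ idₚ ≡ σ
    ∘ₚ-identityʳ σ = perm-ext λ i → trans (app-∘ₚ σ idₚ i) (cong (app σ) (app-idₚ i))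

    InjectivePerm : Perm n → Set
    InjectivePerm σ = Injective _≡_ _≡_ (app σ)

    ∘ₚ-injective : (σ τ : Perm n) → InjectivePerm σ → InjectivePerm τ → InjectivePerm (σ ∘ₚ τ)
    ∘ₚ-injective σ τ σ-inj τ-inj {i} {j} eq =
      τ-inj (σ-inj (trans (sym (app-∘ₚ σ τ i)) (trans eq (app-∘ₚ σ τ j))))

    isPerm⇒injective : (σ : Perm n) → isPerm σ ≡ true → InjectivePerm σ
    isPerm⇒injective σ σ-perm {i} {j} σi≡σj
      with i F.≟ j | app σ i F.≟ app σ j | all-allFin⁻ (all-allFin⁻ σ-perm i) j
    ... | yes i≡j | _        | _  = i≡j
    ... | no _    | no σi≢σj | _  = ⊥-elim (σi≢σj σi≡σj)
    ... | no _    | yes _    | ()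

    injective⇒isPerm : (σ : Perm n) → InjectivePerm σ → isPerm σ ≡ true
    injective⇒isPerm σ σ-inj = all-allFin⁺ λ i → all-allFin⁺ λ j → distinct i j
      where
      distinct : ∀ i j → ((i ≟ᶠ j) ∨ not (app σ i ≟ᶠ app σ j)) ≡ true
      distinct i j with i F.≟ j
      ... | yes _  = refl
      ... | no i≢j with app σ i F.≟ app σ j
      ...   | yes σi≡σj = ⊥-elim (i≢j (σ-inj σi≡σj))
      ...   | no _      = refl

    app-inverse : (σ τ : Perm n) → σ ∘ₚ τ ≡ idₚ → ∀ i → app σ (app τ i) ≡ i
    app-inverse σ τ σ∘τ≡id i =
      trans (sym (app-∘ₚ σ τ i)) (trans (cong (λ π → app π i) σ∘τ≡id) (app-idₚ i))

    leftInverse⇒injective : (σ τ : Perm n) → τ ∘ₚ σ ≡ idₚ → InjectivePerm σ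
    leftInverse⇒injective σ τ τ∘σ≡id {i} {j} σi≡σj = begin
      i                  ≡⟨ app-inverse τ σ τ∘σ≡id i ⟨
      app τ (app σ i)    ≡⟨ cong (app τ) σi≡σj ⟩
      app τ (app σ j)    ≡⟨ app-inverse τ σ τ∘σ≡id j ⟩
      j                  ∎
      where open ≡-Reasoning

    rightInverse⇒leftInverse : (σ τ : Perm n) → InjectivePerm σ → σ ∘ₚ τ ≡ idₚ → τ ∘ₚ σ ≡ idₚ
    rightInverse⇒leftInverse σ τ σ-inj σ∘τ≡id = perm-ext λ i →
      trans (app-∘ₚ τ σ i) (trans (σ-inj (app-inverse σ τ σ∘τ≡id (app σ i))) (sym (app-idₚ i)))

    ∘ₚ-inverse-cancelˡ : (σ σ⁻¹ : Perm n) → σ ∘ₚ σ⁻¹ ≡ idₚ → (τ : Perm n) → σ ∘ₚ (σ⁻¹ ∘ₚ τ) ≡ τ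
    ∘ₚ-inverse-cancelˡ σ σ⁻¹ σ∘σ⁻¹≡id τ =
      trans (sym (∘ₚ-assoc σ σ⁻¹ τ)) (trans (cong (_∘ₚ τ) σ∘σ⁻¹≡id) (∘ₚ-identityˡ τ))

    ∘ₚ-inverse-cancelʳ : (σ σ⁻¹ : Perm n) → σ⁻¹ ∘ₚ σ ≡ idₚ → (τ : Perm n) → (τ ∘ₚ σ⁻¹) ∘ₚ σ ≡ τ
    ∘ₚ-inverse-cancelʳ σ σ⁻¹ σ⁻¹∘σ≡id τ =
      trans (∘ₚ-assoc τ σ⁻¹ σ) (trans (cong (τ ∘ₚ_) σ⁻¹∘σ≡id) (∘ₚ-identityʳ τ))

    ∘ₚ-cancelˡ : (σ σ⁻¹ : Perm n) → σ⁻¹ ∘ₚ σ ≡ idₚ → Injective _≡_ _≡_ (σ ∘ₚ_)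
    ∘ₚ-cancelˡ σ σ⁻¹ σ⁻¹∘σ≡id {τ} {υ} στ≡συ = begin
      τ                  ≡⟨ ∘ₚ-inverse-cancelˡ σ⁻¹ σ σ⁻¹∘σ≡id τ ⟨
      σ⁻¹ ∘ₚ (σ ∘ₚ τ)    ≡⟨ cong (σ⁻¹ ∘ₚ_) στ≡συ ⟩
      σ⁻¹ ∘ₚ (σ ∘ₚ υ)    ≡⟨ ∘ₚ-inverse-cancelˡ σ⁻¹ σ σ⁻¹∘σ≡id υ ⟩
      υ                  ∎
      where open ≡-Reasoning

    ∘ₚ-cancelʳ : (σ σ⁻¹ : Perm n) → σ ∘ₚ σ⁻¹ ≡ idₚ → Injective _≡_ _≡_ (_∘ₚ σ)
    ∘ₚ-cancelʳ σ σ⁻¹ σ∘σ⁻¹≡id {τ} {υ} τσ≡υσ = begin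
      τ                  ≡⟨ ∘ₚ-inverse-cancelʳ σ⁻¹ σ σ∘σ⁻¹≡id τ ⟨
      (τ ∘ₚ σ) ∘ₚ σ⁻¹    ≡⟨ cong (_∘ₚ σ⁻¹) τσ≡υσ ⟩
      (υ ∘ₚ σ) ∘ₚ σ⁻¹    ≡⟨ ∘ₚ-inverse-cancelʳ σ⁻¹ σ σ∘σ⁻¹≡id υ ⟩
      υ                  ∎
      where open ≡-Reasoning

  injective⇒surjective : {n : ℕ} {f : Fin n → Fin n} → Injective _≡_ _≡_ f → ∀ j → ∃ λ i → f i ≡ j
  injective⇒surjective {suc m} {f} f-inj j with Fin.any? (λ i → f i F.≟ j)
  ... | yes hit  = hit
  ... | no ¬hit = ⊥-elim (ℕ.<-irrefl refl (Fin.injective⇒≤ squeeze-injective))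
    where
    squeeze : Fin (suc m) → Fin m
    squeeze i = punchOut {i = j} λ j≡fi → ¬hit (i , sym j≡fi)
    squeeze-injective : Injective _≡_ _≡_ squeeze
    squeeze-injective eq = f-inj (Fin.punchOut-injective {i = j} _ _ eq)

  inverse : {n : ℕ} (σ : Perm n) → InjectivePerm σ → ∃ λ σ⁻¹ → σ ∘ₚ σ⁻¹ ≡ idₚ × σ⁻¹ ∘ₚ σ ≡ idₚ
  inverse σ σ-inj = σ⁻¹ , σ∘σ⁻¹≡id , rightInverse⇒leftInverse σ σ⁻¹ σ-inj σ∘σ⁻¹≡id
    where
    preimage : ∀ j → ∃ λ i → app σ i ≡ j
    preimage = injective⇒surjective σ-inj
    σ⁻¹ : Perm _
    σ⁻¹ = tabulate (proj₁ ∘ preimage)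
    σ∘σ⁻¹≡id : σ ∘ₚ σ⁻¹ ≡ idₚ
    σ∘σ⁻¹≡id = perm-ext λ j → begin
      app (σ ∘ₚ σ⁻¹) j            ≡⟨ app-∘ₚ σ σ⁻¹ j ⟩
      app σ (app σ⁻¹ j)           ≡⟨ cong (app σ) (Vec.lookup∘tabulate _ j) ⟩
      app σ (proj₁ (preimage j))  ≡⟨ proj₂ (preimage j) ⟩
      j                           ≡⟨ app-idₚ j ⟨
      app idₚ j                   ∎
      where open ≡-Reasoning

  allVecs≡cartesianProduct : (k m : ℕ) →
                             allVecs (suc k) m ≡ cartesianProductWith _∷ᵥ_ (allFin m) (allVecs k m)
  allVecs≡cartesianProduct k m = go (allFin m)
    where
    go : (xs : List (Fin m)) →
         concatMap (λ x → map (x ∷ᵥ_) (allVecs k m)) xs ≡ cartesianProductWith _∷ᵥ_ xs (allVecs k m)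
    go []       = refl
    go (x ∷ xs) = cong (map (x ∷ᵥ_) (allVecs k m) ++_) (go xs)

  ∈-allVecs : (k m : ℕ) (v : Vec (Fin m) k) → v ∈ allVecs k m
  ∈-allVecs zero    m []ᵥ      = here refl
  ∈-allVecs (suc k) m (x ∷ᵥ v) = subst (x ∷ᵥ v ∈_) (sym (allVecs≡cartesianProduct k m))
    (∈-cartesianProductWith⁺ _∷ᵥ_ (∈-allFin x) (∈-allVecs k m v))

  allVecs-unique : (k m : ℕ) → Unique (allVecs k m)
  allVecs-unique zero    m = All.[] ∷ []
  allVecs-unique (suc k) m = subst Unique (sym (allVecs≡cartesianProduct k m))
    (Unique.cartesianProductWith⁺ _∷ᵥ_ Vec.∷-injective (Unique.allFin⁺ m) (allVecs-unique k m))

  allPerms-unique : (n : ℕ) → Unique (allPerms n)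
  allPerms-unique n = filterᵇ-unique isPerm (allVecs-unique n n)

  ∈-allPerms : {n : ℕ} (σ : Perm n) → isPerm σ ≡ true → σ ∈ allPerms n
  ∈-allPerms {n} σ = ∈-filterᵇ⁺ isPerm (∈-allVecs n n σ)

  -- inC T and inR T are, definitionally, stabiliser (colOf T) and stabiliser (rowOf T).
  stabiliser : {n : ℕ} → (Fin n → ℕ) → Perm n → Bool
  stabiliser {n} κ σ = isPerm σ ∧ all (λ i → κ (app σ i) ≡ᵇ κ i) (allFin n)

  module _ {n : ℕ} (κ : Fin n → ℕ) where

    stabiliser⁺ : (σ : Perm n) → InjectivePerm σ → (∀ i → κ (app σ i) ≡ κ i) → stabiliser κ σ ≡ true
    stabiliser⁺ σ σ-inj κ∘σ≡κ rewrite injective⇒isPerm σ σ-inj =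
      all-allFin⁺ λ i → Equivalence.to T-≡ (ℕ.≡⇒≡ᵇ _ _ (κ∘σ≡κ i))

    stabiliser⁻ : (σ : Perm n) → stabiliser κ σ ≡ true → InjectivePerm σ × (∀ i → κ (app σ i) ≡ κ i)
    stabiliser⁻ σ σ-stab with isPerm σ in σ-perm
    ... | true = isPerm⇒injective σ σ-perm ,
                 λ i → ℕ.≡ᵇ⇒≡ _ _ (Equivalence.from T-≡ (all-allFin⁻ σ-stab i))

    stabiliser-isSubgroup : IsSubgroup (stabiliser κ)
    stabiliser-isSubgroup = stabiliser-perm , id-stab , ∘ₚ-stab , inverse-stab
      where
      stabiliser-perm : ∀ σ → stabiliser κ σ ≡ true → isPerm σ ≡ true
      stabiliser-perm σ σ-stab = injective⇒isPerm σ (proj₁ (stabiliser⁻ σ σ-stab))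
      id-stab : stabiliser κ idₚ ≡ true
      id-stab = stabiliser⁺ idₚ (leftInverse⇒injective idₚ idₚ (∘ₚ-identityˡ idₚ)) (λ i → cong κ (app-idₚ i))
      ∘ₚ-stab : ∀ σ τ → stabiliser κ σ ≡ true → stabiliser κ τ ≡ true → stabiliser κ (σ ∘ₚ τ) ≡ true
      ∘ₚ-stab σ τ σ-stab τ-stab =
        let (σ-inj , κ∘σ≡κ) = stabiliser⁻ σ σ-stab ; (τ-inj , κ∘τ≡κ) = stabiliser⁻ τ τ-stab
        in stabiliser⁺ (σ ∘ₚ τ) (∘ₚ-injective σ τ σ-inj τ-inj)
             (λ i → trans (cong κ (app-∘ₚ σ τ i)) (trans (κ∘σ≡κ (app τ i)) (κ∘τ≡κ i)))
      inverse-stab : ∀ σ → stabiliser κ σ ≡ true → ∃ λ σ⁻¹ → stabiliser κ σ⁻¹ ≡ true × σ ∘ₚ σ⁻¹ ≡ idₚ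
      inverse-stab σ σ-stab with stabiliser⁻ σ σ-stab
      ... | σ-inj , κ∘σ≡κ with inverse σ σ-inj
      ... | σ⁻¹ , σ∘σ⁻¹≡id , _ =
        σ⁻¹ ,
        stabiliser⁺ σ⁻¹ (leftInverse⇒injective σ⁻¹ σ σ∘σ⁻¹≡id)
          (λ i → trans (sym (κ∘σ≡κ (app σ⁻¹ i))) (cong κ (app-inverse σ σ⁻¹ σ∘σ⁻¹≡id i))) ,
        σ∘σ⁻¹≡id

module Subgroups {n : ℕ} {G : Perm n → Bool} (G-subgroup : IsSubgroup G) where

  open Permutations
  open IntegerSums using (∑; ∑-reindex)
  open import Data.Integer using (ℤ)

  G-perm : ∀ {σ} → G σ ≡ true → isPerm σ ≡ true
  G-perm = proj₁ G-subgroup _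

  G-∘ₚ : (σ τ : Perm n) → G σ ≡ true → G τ ≡ true → G (σ ∘ₚ τ) ≡ true
  G-∘ₚ = proj₁ (proj₂ (proj₂ G-subgroup))

  G-injective : (σ : Perm n) → G σ ≡ true → InjectivePerm σ
  G-injective σ Gσ = isPerm⇒injective σ (G-perm Gσ)

  G-inverse : (σ : Perm n) → G σ ≡ true → ∃ λ σ⁻¹ → G σ⁻¹ ≡ true × σ ∘ₚ σ⁻¹ ≡ idₚ × σ⁻¹ ∘ₚ σ ≡ idₚ
  G-inverse σ Gσ =
    let (σ⁻¹ , Gσ⁻¹ , σ∘σ⁻¹≡id) = proj₂ (proj₂ (proj₂ G-subgroup)) σ Gσ
    in σ⁻¹ , Gσ⁻¹ , σ∘σ⁻¹≡id , rightInverse⇒leftInverse σ σ⁻¹ (G-injective σ Gσ) σ∘σ⁻¹≡id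

  members : List (Perm n)
  members = filterᵇ G (allPerms n)

  members-unique : Unique members
  members-unique = filterᵇ-unique G (allPerms-unique n)

  ∈-members⁺ : ∀ {σ} → G σ ≡ true → σ ∈ members
  ∈-members⁺ {σ} Gσ = ∈-filterᵇ⁺ G (∈-allPerms σ (G-perm Gσ)) Gσ

  ∈-members⁻ : ∀ {σ} → σ ∈ members → G σ ≡ true
  ∈-members⁻ σ∈ = proj₂ (∈-filterᵇ⁻ G {xs = allPerms n} σ∈)

  ∑-∘ₚˡ : (γ : Perm n) → G γ ≡ true → (f : Perm n → ℤ) → ∑[ τ ∈ members ] f (γ ∘ₚ τ) ≡ ∑ members f
  ∑-∘ₚˡ γ Gγ with G-inverse γ Gγ
  ... | γ⁻¹ , Gγ⁻¹ , γ∘γ⁻¹≡id , γ⁻¹∘γ≡id =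
    ∑-reindex members members-unique (γ ∘ₚ_) (∘ₚ-cancelˡ γ γ⁻¹ γ⁻¹∘γ≡id)
      (λ {τ} τ∈ → ∈-members⁺ (G-∘ₚ γ τ Gγ (∈-members⁻ τ∈)))
      (λ {τ} τ∈ → γ⁻¹ ∘ₚ τ , ∈-members⁺ (G-∘ₚ γ⁻¹ τ Gγ⁻¹ (∈-members⁻ τ∈)) , ∘ₚ-inverse-cancelˡ γ γ⁻¹ γ∘γ⁻¹≡id τ)

  ∑-∘ₚʳ : (γ : Perm n) → G γ ≡ true → (f : Perm n → ℤ) → ∑[ τ ∈ members ] f (τ ∘ₚ γ) ≡ ∑ members f
  ∑-∘ₚʳ γ Gγ with G-inverse γ Gγ
  ... | γ⁻¹ , Gγ⁻¹ , γ∘γ⁻¹≡id , γ⁻¹∘γ≡id =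
    ∑-reindex members members-unique (_∘ₚ γ) (∘ₚ-cancelʳ γ γ⁻¹ γ∘γ⁻¹≡id)
      (λ {τ} τ∈ → ∈-members⁺ (G-∘ₚ τ γ (∈-members⁻ τ∈) Gγ))
      (λ {τ} τ∈ → τ ∘ₚ γ⁻¹ , ∈-members⁺ (G-∘ₚ τ γ⁻¹ (∈-members⁻ τ∈) Gγ⁻¹) , ∘ₚ-inverse-cancelʳ γ γ⁻¹ γ⁻¹∘γ≡id τ)

module Inversions where

  open import Data.Bool using (_∧_; _xor_; not; false)
  open import Data.Bool.Properties using (xor-annihilates-not; not-involutive)
  open import Function using (case_of_)
  open import Data.Empty using (⊥-elim)
  open import Data.Fin as F using (toℕ)
  import Data.Fin.Properties as Fin
  open import Data.List using (allFin; length)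
  open import Data.List.Membership.Propositional.Properties using (∈-allFin)
  open import Data.Nat using (_+_; _*_; _<_; _<ᵇ_)
  import Data.Nat.Properties as ℕ
  open import Relation.Binary.Definitions using (tri<; tri≈; tri>)
  open import Relation.Nullary using (¬_; yes; no)
  open Permutations
  open FiniteSums ℕ.+-0-isCommutativeMonoid

  [_] : Bool → ℕ
  [ true  ] = 1
  [ false ] = 0

  length-filterᵇ : {A : Set} (p : A → Bool) (xs : List A) → length (filterᵇ p xs) ≡ ∑[ x ∈ xs ] [ p x ]
  length-filterᵇ p []       = refl
  length-filterᵇ p (x ∷ xs) with p x
  ... | true  = cong suc (length-filterᵇ p xs)
  ... | false = length-filterᵇ p xs

  module _ {n : ℕ} where

    _<ᶠ_ : Fin n → Fin n → Bool
    i <ᶠ j = toℕ i <ᵇ toℕ j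

    <ᶠ-true : ∀ {i j} → toℕ i < toℕ j → (i <ᶠ j) ≡ true
    <ᶠ-true {i} {j} i<j with i <ᶠ j | ℕ.<⇒<ᵇ i<j
    ... | true | _ = refl

    <ᶠ-false : ∀ {i j} → ¬ toℕ i < toℕ j → (i <ᶠ j) ≡ false
    <ᶠ-false {i} {j} i≮j with i <ᶠ j | ℕ.<ᵇ⇒< (toℕ i) (toℕ j)
    ... | false | _    = refl
    ... | true  | i<j = ⊥-elim (i≮j (i<j _))

    <ᶠ-irrefl : (i : Fin n) → (i <ᶠ i) ≡ false
    <ᶠ-irrefl i = <ᶠ-false {i} {i} (ℕ.<-irrefl refl)

    <ᶠ-asym : {i j : Fin n} → ¬ i ≡ j → (j <ᶠ i) ≡ not (i <ᶠ j)
    <ᶠ-asym {i} {j} i≢j with ℕ.<-cmp (toℕ i) (toℕ j)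
    ... | tri< i<j _ _ = trans (<ᶠ-false (ℕ.<⇒≯ i<j)) (cong not (sym (<ᶠ-true i<j)))
    ... | tri≈ _ i≡j _ = ⊥-elim (i≢j (Fin.toℕ-injective i≡j))
    ... | tri> _ _ j<i = trans (<ᶠ-true j<i) (cong not (sym (<ᶠ-false (ℕ.<⇒≯ j<i))))

    #pairs : (Fin n → Fin n → Bool) → ℕ
    #pairs g = ∑[ i ∈ allFin n ] ∑[ j ∈ allFin n ] [ g i j ]

    #ascending : (Fin n → Fin n → Bool) → ℕ
    #ascending g = #pairs (λ i j → (i <ᶠ j) ∧ g i j)

    #pairs-cong : {g h : Fin n → Fin n → Bool} → (∀ i j → g i j ≡ h i j) → #pairs g ≡ #pairs h
    #pairs-cong g≡h = ∑-cong (allFin n) λ {i} _ → ∑-cong (allFin n) λ {j} _ → cong [_] (g≡h i j)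

    #pairs-distrib-+ : (f g : Fin n → Fin n → ℕ) →
      ∑[ i ∈ allFin n ] ∑[ j ∈ allFin n ] (f i j + g i j) ≡
      ∑[ i ∈ allFin n ] ∑[ j ∈ allFin n ] f i j + ∑[ i ∈ allFin n ] ∑[ j ∈ allFin n ] g i j
    #pairs-distrib-+ f g =
      trans (∑-cong (allFin n) λ {i} _ → ∑-distrib-+ (allFin n) (f i) (g i)) (∑-distrib-+ (allFin n) _ _)

    #pairs≡2*#ascending : (g : Fin n → Fin n → Bool) → (∀ i j → g i j ≡ g j i) →
                         (∀ i → g i i ≡ false) → #pairs g ≡ 2 * #ascending g
    #pairs≡2*#ascending g g-sym g-irrefl = begin
      #pairs g
        ≡⟨ ∑-cong (allFin n) (λ {i} _ → ∑-cong (allFin n) λ {j} _ → split i j) ⟩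
      ∑[ i ∈ allFin n ] ∑[ j ∈ allFin n ] ([ (i <ᶠ j) ∧ g i j ] + [ (j <ᶠ i) ∧ g j i ])
        ≡⟨ #pairs-distrib-+ _ _ ⟩
      #ascending g + ∑[ i ∈ allFin n ] ∑[ j ∈ allFin n ] [ (j <ᶠ i) ∧ g j i ]
        ≡⟨ cong (#ascending g +_) (∑-comm (allFin n) (allFin n) _) ⟩
      #ascending g + #ascending g
        ≡⟨ cong (#ascending g +_) (ℕ.+-identityʳ _) ⟨
      2 * #ascending g ∎
      where
      open ≡-Reasoning
      split : ∀ i j → [ g i j ] ≡ [ (i <ᶠ j) ∧ g i j ] + [ (j <ᶠ i) ∧ g j i ]
      split i j with ℕ.<-cmp (toℕ i) (toℕ j)
      ... | tri< i<j _ _ rewrite <ᶠ-true i<j | <ᶠ-false (ℕ.<⇒≯ i<j) = sym (ℕ.+-identityʳ _)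
      ... | tri≈ _ i≡j _ rewrite Fin.toℕ-injective i≡j | g-irrefl j | <ᶠ-irrefl j = refl
      ... | tri> _ _ j<i rewrite <ᶠ-true j<i | <ᶠ-false (ℕ.<⇒≯ j<i) | g-sym i j = refl

    ∑-allFin-reindex : (τ : Perm n) → InjectivePerm τ → (f : Fin n → ℕ) →
                       ∑[ i ∈ allFin n ] f (app τ i) ≡ ∑ (allFin n) f
    ∑-allFin-reindex τ τ-inj = ∑-reindex (allFin n) (Unique.allFin⁺ n) (app τ) τ-inj (λ _ → ∈-allFin _)
      (λ {j} _ → let (i , τi≡j) = injective⇒surjective τ-inj j in i , ∈-allFin i , τi≡j)

    #pairs-reindex : (τ : Perm n) → InjectivePerm τ → (g : Fin n → Fin n → Bool) →
                     #pairs (λ i j → g (app τ i) (app τ j)) ≡ #pairs g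
    #pairs-reindex τ τ-inj g =
      trans (∑-cong (allFin n) λ {i} _ → ∑-allFin-reindex τ τ-inj (λ j → [ g (app τ i) j ]))
            (∑-allFin-reindex τ τ-inj (λ i → ∑[ j ∈ allFin n ] [ g i j ]))

    #ascending-reindex : (τ : Perm n) → InjectivePerm τ → (g : Fin n → Fin n → Bool) →
                         (∀ i j → g i j ≡ g j i) → (∀ i → g i i ≡ false) →
                         #ascending (λ i j → g (app τ i) (app τ j)) ≡ #ascending g
    #ascending-reindex τ τ-inj g g-sym g-irrefl = ℕ.*-cancelˡ-≡ _ _ 2 (begin
      2 * #ascending (λ i j → g (app τ i) (app τ j))
        ≡⟨ #pairs≡2*#ascending _ (λ i j → g-sym (app τ i) (app τ j)) (λ i → g-irrefl (app τ i)) ⟨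
      #pairs (λ i j → g (app τ i) (app τ j))
        ≡⟨ #pairs-reindex τ τ-inj g ⟩
      #pairs g
        ≡⟨ #pairs≡2*#ascending g g-sym g-irrefl ⟩
      2 * #ascending g ∎)
      where open ≡-Reasoning

    #ascending-xor : (a b : Fin n → Fin n → Bool) →
      let K = #ascending (λ i j → a i j ∧ b i j) in
      #ascending (λ i j → a i j xor b i j) + (K + K) ≡ #ascending a + #ascending b
    #ascending-xor a b = begin
      #ascending (λ i j → a i j xor b i j) + (K + K)
        ≡⟨ cong (#ascending (λ i j → a i j xor b i j) +_) (#pairs-distrib-+ _ _) ⟨
      #ascending (λ i j → a i j xor b i j) + ∑[ i ∈ allFin n ] ∑[ j ∈ allFin n ] (both i j + both i j)
        ≡⟨ #pairs-distrib-+ _ _ ⟨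
      ∑[ i ∈ allFin n ] ∑[ j ∈ allFin n ] ([ (i <ᶠ j) ∧ (a i j xor b i j) ] + (both i j + both i j))
        ≡⟨ ∑-cong (allFin n) (λ {i} _ → ∑-cong (allFin n) λ {j} _ → count (i <ᶠ j) (a i j) (b i j)) ⟩
      ∑[ i ∈ allFin n ] ∑[ j ∈ allFin n ] ([ (i <ᶠ j) ∧ a i j ] + [ (i <ᶠ j) ∧ b i j ])
        ≡⟨ #pairs-distrib-+ _ _ ⟩
      #ascending a + #ascending b ∎
      where
      open ≡-Reasoning
      K = #ascending (λ i j → a i j ∧ b i j)
      both : Fin n → Fin n → ℕ
      both i j = [ (i <ᶠ j) ∧ (a i j ∧ b i j) ]
      count : ∀ l x y → [ l ∧ (x xor y) ] + ([ l ∧ (x ∧ y) ] + [ l ∧ (x ∧ y) ]) ≡ [ l ∧ x ] + [ l ∧ y ]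
      count false x     y     = refl
      count true  true  true  = refl
      count true  true  false = refl
      count true  false true  = refl
      count true  false false = refl

    flips : Perm n → Fin n → Fin n → Bool
    flips σ i j = (i <ᶠ j) xor (app σ i <ᶠ app σ j)

    flips-sym : (σ : Perm n) → InjectivePerm σ → ∀ i j → flips σ i j ≡ flips σ j i
    flips-sym σ σ-inj i j with i F.≟ j
    ... | yes refl = refl
    ... | no i≢j = sym (trans (cong₂ _xor_ (<ᶠ-asym i≢j) (<ᶠ-asym (i≢j ∘ σ-inj)))
                              (xor-annihilates-not (i <ᶠ j) (app σ i <ᶠ app σ j)))

    flips-irrefl : (σ : Perm n) → ∀ i → flips σ i i ≡ false
    flips-irrefl σ i rewrite <ᶠ-irrefl i | <ᶠ-irrefl (app σ i) = refl

    flips-∘ₚ : (σ τ : Perm n) → ∀ i j → flips (σ ∘ₚ τ) i j ≡ flips τ i j xor flips σ (app τ i) (app τ j)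
    flips-∘ₚ σ τ i j rewrite app-∘ₚ σ τ i | app-∘ₚ σ τ j = xor-through (i <ᶠ j) _ _
      where
      xor-through : ∀ a b c → a xor c ≡ (a xor b) xor (b xor c)
      xor-through true  true  c = refl
      xor-through true  false c = refl
      xor-through false true  c = sym (not-involutive c)
      xor-through false false c = refl

    inversions≡#ascending-flips : (σ : Perm n) → InjectivePerm σ → inversions σ ≡ #ascending (flips σ)
    inversions≡#ascending-flips σ σ-inj = begin
      inversions σ
        ≡⟨ length-filterᵇ _ (concatMap (λ i → map (i ,_) (allFin n)) (allFin n)) ⟩
      ∑[ ij ∈ concatMap (λ i → map (i ,_) (allFin n)) (allFin n) ] [ inverted ij ]
        ≡⟨ ∑-concatMap _ (allFin n) _ ⟩
      ∑[ i ∈ allFin n ] ∑[ ij ∈ map (i ,_) (allFin n) ] [ inverted ij ]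
        ≡⟨ ∑-cong (allFin n) (λ {i} _ → trans (∑-map (i ,_) (allFin n) _)
                                              (∑-cong (allFin n) λ {j} _ → inverted≡flips i j)) ⟩
      #ascending (flips σ) ∎
      where
      open ≡-Reasoning
      inverted : Fin n × Fin n → Bool
      inverted (i , j) = (i <ᶠ j) ∧ (app σ j <ᶠ app σ i)
      inverted≡flips : ∀ i j → [ inverted (i , j) ] ≡ [ (i <ᶠ j) ∧ flips σ i j ]
      inverted≡flips i j with i <ᶠ j in i<j
      ... | false = refl
      ... | true  = cong [_] (<ᶠ-asym (λ σi≡σj → i≢j (σ-inj σi≡σj)))
        where
        i≢j : ¬ i ≡ j
        i≢j refl = case trans (sym i<j) (<ᶠ-irrefl i) of λ ()

    inversions-∘ₚ : (σ τ : Perm n) → InjectivePerm σ → InjectivePerm τ →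
                    ∃ λ K → inversions (σ ∘ₚ τ) + (K + K) ≡ inversions τ + inversions σ
    inversions-∘ₚ σ τ σ-inj τ-inj = K , (begin
      inversions (σ ∘ₚ τ) + (K + K)
        ≡⟨ cong (_+ (K + K)) (trans (inversions≡#ascending-flips (σ ∘ₚ τ) (∘ₚ-injective σ τ σ-inj τ-inj))
                                    (#pairs-cong λ i j → cong ((i <ᶠ j) ∧_) (flips-∘ₚ σ τ i j))) ⟩
      #ascending (λ i j → flips τ i j xor flips σ (app τ i) (app τ j)) + (K + K)
        ≡⟨ #ascending-xor (flips τ) (λ i j → flips σ (app τ i) (app τ j)) ⟩
      #ascending (flips τ) + #ascending (λ i j → flips σ (app τ i) (app τ j))
        ≡⟨ cong₂ _+_ (sym (inversions≡#ascending-flips τ τ-inj))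
                     (trans (#ascending-reindex τ τ-inj (flips σ) (flips-sym σ σ-inj) (flips-irrefl σ))
                            (sym (inversions≡#ascending-flips σ σ-inj))) ⟩
      inversions τ + inversions σ ∎)
      where
      open ≡-Reasoning
      K = #ascending (λ i j → flips τ i j ∧ flips σ (app τ i) (app τ j))

module Sign where

  open import Data.Bool using (if_then_else_; false)
  open import Data.Integer using (ℤ; 1ℤ; _*_; -_)
  import Data.Integer.Properties as ℤ
  open import Data.Nat using (_+_; _≡ᵇ_)
  open import Data.Nat.DivMod using (_%_; [m+n]%n≡m%n)
  import Data.Nat.Properties as ℕ
  open Permutations using (InjectivePerm)
  open Inversions using (inversions-∘ₚ)

  -- sgn σ unfolds to parity (inversions σ).
  parity : ℕ → ℤ
  parity k = if (k % 2) ≡ᵇ 0 then 1ℤ else -1ℤ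

  parity-suc-suc : ∀ k → parity (suc (suc k)) ≡ parity k
  parity-suc-suc k =
    cong (λ r → if r ≡ᵇ 0 then 1ℤ else -1ℤ) (trans (cong (_% 2) (ℕ.+-comm 2 k)) ([m+n]%n≡m%n k 2))

  parity-suc : ∀ k → parity (suc k) ≡ - parity k
  parity-suc zero          = refl
  parity-suc (suc zero)    = refl
  parity-suc (suc (suc k)) =
    trans (parity-suc-suc (suc k)) (trans (parity-suc k) (cong -_ (sym (parity-suc-suc k))))

  parity-+ : ∀ m k → parity (m + k) ≡ parity m * parity k
  parity-+ zero    k = sym (ℤ.*-identityˡ (parity k))
  parity-+ (suc m) k = begin
    parity (suc (m + k))      ≡⟨ parity-suc (m + k) ⟩
    - parity (m + k)          ≡⟨ cong -_ (parity-+ m k) ⟩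
    - (parity m * parity k)   ≡⟨ ℤ.neg-distribˡ-* (parity m) (parity k) ⟩
    - parity m * parity k     ≡⟨ cong (_* parity k) (parity-suc m) ⟨
    parity (suc m) * parity k ∎
    where open ≡-Reasoning

  parity-double : ∀ k → parity (k + k) ≡ 1ℤ
  parity-double k with (k % 2) ≡ᵇ 0 | parity-+ k k
  ... | true  | eq = eq
  ... | false | eq = eq

  sgn-∘ₚ : {n : ℕ} (σ τ : Perm n) → InjectivePerm σ → InjectivePerm τ → sgn (σ ∘ₚ τ) ≡ sgn σ * sgn τ
  sgn-∘ₚ σ τ σ-inj τ-inj with inversions-∘ₚ σ τ σ-inj τ-inj
  ... | K , eq = begin
    sgn (σ ∘ₚ τ)                               ≡⟨ ℤ.*-identityʳ _ ⟨
    parity (inversions (σ ∘ₚ τ)) * 1ℤ          ≡⟨ cong (parity (inversions (σ ∘ₚ τ)) *_) (parity-double K) ⟨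
    parity (inversions (σ ∘ₚ τ)) * parity (K + K) ≡⟨ parity-+ (inversions (σ ∘ₚ τ)) (K + K) ⟨
    parity (inversions (σ ∘ₚ τ) + (K + K))    ≡⟨ cong parity eq ⟩
    parity (inversions τ + inversions σ)      ≡⟨ parity-+ (inversions τ) (inversions σ) ⟩
    sgn τ * sgn σ                             ≡⟨ ℤ.*-comm (sgn τ) (sgn σ) ⟩
    sgn σ * sgn τ                             ∎
    where open ≡-Reasoning

module Cancellation {n : ℕ} (T : List (List (Fin n))) (S : List (List ℕ))
                    {U : Perm n → Bool} (U-subgroup : IsSubgroup U) (m : Monomial n) where

  open import Data.Bool using (if_then_else_; false)
  open import Data.Integer using (ℤ; 0ℤ; 1ℤ; _*_; -_; _≟_)
  import Data.Integer.Properties as ℤ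
  import Data.Fin.Properties as Fin
  import Data.Vec.Properties as Vec
  open import Data.Sum using (_⊎_; inj₁; inj₂)
  open import Data.Empty using (⊥-elim)
  open import Relation.Binary.Definitions using (DecidableEquality)
  open import Relation.Nullary using (¬_; yes; no)
  open IntegerSums
  open Permutations
  open Sign using (sgn-∘ₚ)

  module U = Subgroups U-subgroup
  module C = Subgroups (stabiliser-isSubgroup (colOf T))
  module R = Subgroups (stabiliser-isSubgroup (rowOf T))

  infix 4 _≟ₚ_
  _≟ₚ_ : DecidableEquality (Perm n)
  _≟ₚ_ = Vec.≡-dec Fin._≟_

  hits : Perm n → ℤ
  hits π = if monoEq (actMono π (xTS T S)) m then 1ℤ else 0ℤ

  rowSum : Perm n → ℤ
  rowSum σ = ∑[ ρ ∈ R.members ] hits (σ ∘ₚ ρ)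

  weight : Perm n → ℤ
  weight σ = sgn σ * rowSum σ

  multiplicity : Perm n → ℤ
  multiplicity σ = ∑[ τ ∈ U.members ] ∑[ γ ∈ C.members ] 𝟙 (τ ∘ₚ γ ≟ₚ σ)

  InUC-injective : ∀ {σ} → InUC U T σ → InjectivePerm σ
  InUC-injective (u , c , Uu , Cc , refl) = ∘ₚ-injective u c (U.G-injective u Uu) (C.G-injective c Cc)

  coeff-alphaF : coeff (alphaF U T S) m ≡ ∑[ τ ∈ U.members ] ∑[ γ ∈ C.members ] weight (τ ∘ₚ γ)
  coeff-alphaF = begin
    coeff (alphaF U T S) m                                    ≡⟨ ∑-filterᵇ _ (alphaF U T S) proj₁ ⟩
    ∑[ t ∈ alphaF U T S ] term t                              ≡⟨ ∑-concatMap _ U.members term ⟩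
    ∑[ τ ∈ U.members ] ∑ (concatMap (terms τ) C.members) term
      ≡⟨ ∑-cong U.members (λ {τ} τ∈ → trans (∑-concatMap (terms τ) C.members term)
                                             (∑-cong C.members (∑-terms τ∈))) ⟩
    ∑[ τ ∈ U.members ] ∑[ γ ∈ C.members ] weight (τ ∘ₚ γ)    ∎
    where
    open ≡-Reasoning
    term : ℤ × Monomial n → ℤ
    term t = if monoEq (proj₂ t) m then proj₁ t else 0ℤ
    terms : Perm n → Perm n → List (ℤ × Monomial n)
    terms τ γ = map (λ ρ → (sgn τ * sgn γ , actMono ((τ ∘ₚ γ) ∘ₚ ρ) (xTS T S))) R.members
    term≡ : ∀ c π → term (c , actMono π (xTS T S)) ≡ c * hits π
    term≡ c π with monoEq (actMono π (xTS T S)) m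
    ... | true  = sym (ℤ.*-identityʳ c)
    ... | false = sym (ℤ.*-zeroʳ c)
    ∑-terms : ∀ {τ γ} → τ ∈ U.members → γ ∈ C.members → ∑ (terms τ γ) term ≡ weight (τ ∘ₚ γ)
    ∑-terms {τ} {γ} τ∈ γ∈ = begin
      ∑ (terms τ γ) term
        ≡⟨ ∑-map _ R.members term ⟩
      ∑[ ρ ∈ R.members ] term (sgn τ * sgn γ , actMono ((τ ∘ₚ γ) ∘ₚ ρ) (xTS T S))
        ≡⟨ ∑-cong R.members (λ {ρ} _ → term≡ (sgn τ * sgn γ) ((τ ∘ₚ γ) ∘ₚ ρ)) ⟩
      ∑[ ρ ∈ R.members ] (sgn τ * sgn γ * hits ((τ ∘ₚ γ) ∘ₚ ρ))
        ≡⟨ ∑-*ˡ (sgn τ * sgn γ) R.members _ ⟩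
      sgn τ * sgn γ * rowSum (τ ∘ₚ γ)
        ≡⟨ cong (_* rowSum (τ ∘ₚ γ)) (sgn-∘ₚ τ γ τ-inj γ-inj) ⟨
      weight (τ ∘ₚ γ) ∎
      where
      τ-inj = U.G-injective τ (U.∈-members⁻ τ∈)
      γ-inj = C.G-injective γ (C.∈-members⁻ γ∈)

  ∑UC≡∑multiplicity :
    ∑[ τ ∈ U.members ] ∑[ γ ∈ C.members ] weight (τ ∘ₚ γ) ≡ ∑[ σ ∈ allPerms n ] (multiplicity σ * weight σ)
  ∑UC≡∑multiplicity = ∑∑-fibres _≟ₚ_ _∘ₚ_ U.members C.members (allPerms-unique n) τγ∈ weight
    where
    τγ∈ : ∀ {τ γ} → τ ∈ U.members → γ ∈ C.members → τ ∘ₚ γ ∈ allPerms n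
    τγ∈ {τ} {γ} τ∈ γ∈ = ∈-allPerms (τ ∘ₚ γ) (injective⇒isPerm (τ ∘ₚ γ)
      (∘ₚ-injective τ γ (U.G-injective τ (U.∈-members⁻ τ∈)) (C.G-injective γ (C.∈-members⁻ γ∈))))

  rowSum-∘ₚ : (σ ρ : Perm n) → inR T ρ ≡ true → rowSum (σ ∘ₚ ρ) ≡ rowSum σ
  rowSum-∘ₚ σ ρ Rρ = trans (∑-cong R.members λ {π} _ → cong hits (∘ₚ-assoc σ ρ π))
                           (R.∑-∘ₚˡ ρ Rρ (λ π → hits (σ ∘ₚ π)))

  weight-∘ₚ-odd : (σ ρ : Perm n) → InjectivePerm σ → inR T ρ ≡ true → sgn ρ ≡ -1ℤ →
                  weight (σ ∘ₚ ρ) ≡ - weight σ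
  weight-∘ₚ-odd σ ρ σ-inj Rρ sgnρ≡-1 = begin
    sgn (σ ∘ₚ ρ) * rowSum (σ ∘ₚ ρ)  ≡⟨ cong₂ _*_ (sgn-∘ₚ σ ρ σ-inj (R.G-injective ρ Rρ)) (rowSum-∘ₚ σ ρ Rρ) ⟩
    sgn σ * sgn ρ * rowSum σ        ≡⟨ cong (λ s → sgn σ * s * rowSum σ) sgnρ≡-1 ⟩
    sgn σ * -1ℤ * rowSum σ          ≡⟨ cong (_* rowSum σ) (trans (ℤ.*-comm (sgn σ) -1ℤ) (ℤ.-1*i≡-i (sgn σ))) ⟩
    - sgn σ * rowSum σ              ≡⟨ ℤ.neg-distribˡ-* (sgn σ) (rowSum σ) ⟨
    - weight σ                      ∎
    where open ≡-Reasoning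

  multiplicity≢0⇒InUC : (σ : Perm n) → ¬ multiplicity σ ≡ 0ℤ → InUC U T σ
  multiplicity≢0⇒InUC σ mult≢0 =
    let (τ , τ∈ , ∑≢0) = ∑≢0⇒∃≢0 U.members _ mult≢0
        (γ , γ∈ , 𝟙≢0) = ∑≢0⇒∃≢0 C.members _ ∑≢0
    in τ , γ , U.∈-members⁻ τ∈ , C.∈-members⁻ γ∈ , sym (𝟙≢0⇒ (τ ∘ₚ γ ≟ₚ σ) 𝟙≢0)

  multiplicity-translate : (a σ b : Perm n) → U a ≡ true → inC T b ≡ true →
                           multiplicity ((a ∘ₚ σ) ∘ₚ b) ≡ multiplicity σ
  multiplicity-translate a σ b Ua Cb with U.G-inverse a Ua | C.G-inverse b Cb
  ... | a⁻¹ , _ , _ , a⁻¹∘a≡id | b⁻¹ , _ , b∘b⁻¹≡id , _ = begin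
    ∑[ τ ∈ U.members ] ∑[ γ ∈ C.members ] 𝟙 (τ ∘ₚ γ ≟ₚ E σ)
      ≡⟨ U.∑-∘ₚˡ a Ua (λ τ → ∑[ γ ∈ C.members ] 𝟙 (τ ∘ₚ γ ≟ₚ E σ)) ⟨
    ∑[ τ ∈ U.members ] ∑[ γ ∈ C.members ] 𝟙 ((a ∘ₚ τ) ∘ₚ γ ≟ₚ E σ)
      ≡⟨ ∑-cong U.members (λ {τ} _ → C.∑-∘ₚʳ b Cb (λ γ → 𝟙 ((a ∘ₚ τ) ∘ₚ γ ≟ₚ E σ))) ⟨
    ∑[ τ ∈ U.members ] ∑[ γ ∈ C.members ] 𝟙 ((a ∘ₚ τ) ∘ₚ (γ ∘ₚ b) ≟ₚ E σ)
      ≡⟨ ∑-cong U.members (λ {τ} _ → ∑-cong C.members λ {γ} _ →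
           trans (cong (λ π → 𝟙 (π ≟ₚ E σ)) (regroup τ γ)) (𝟙-injective _≟ₚ_ E E-injective (τ ∘ₚ γ) σ)) ⟩
    ∑[ τ ∈ U.members ] ∑[ γ ∈ C.members ] 𝟙 (τ ∘ₚ γ ≟ₚ σ) ∎
    where
    open ≡-Reasoning
    E : Perm n → Perm n
    E π = (a ∘ₚ π) ∘ₚ b
    E-injective : Injective _≡_ _≡_ E
    E-injective = ∘ₚ-cancelˡ a a⁻¹ a⁻¹∘a≡id ∘ ∘ₚ-cancelʳ b b⁻¹ b∘b⁻¹≡id
    regroup : ∀ τ γ → (a ∘ₚ τ) ∘ₚ (γ ∘ₚ b) ≡ E (τ ∘ₚ γ)
    regroup τ γ = trans (sym (∘ₚ-assoc (a ∘ₚ τ) γ b)) (cong (_∘ₚ b) (∘ₚ-assoc a τ γ))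

  multiplicity-invariant : ∀ {σ σ′} → InUC U T σ → InUC U T σ′ → multiplicity σ′ ≡ multiplicity σ
  multiplicity-invariant (u , c , Uu , Cc , refl) (u′ , c′ , Uu′ , Cc′ , refl)
    with U.G-inverse u Uu | C.G-inverse c Cc
  ... | u⁻¹ , Uu⁻¹ , _ , u⁻¹∘u≡id | c⁻¹ , Cc⁻¹ , c∘c⁻¹≡id , _ =
    trans (cong multiplicity (sym translate)) (multiplicity-translate
      (u′ ∘ₚ u⁻¹) (u ∘ₚ c) (c⁻¹ ∘ₚ c′) (U.G-∘ₚ u′ u⁻¹ Uu′ Uu⁻¹) (C.G-∘ₚ c⁻¹ c′ Cc⁻¹ Cc′))
    where
    open ≡-Reasoning
    translate : ((u′ ∘ₚ u⁻¹) ∘ₚ (u ∘ₚ c)) ∘ₚ (c⁻¹ ∘ₚ c′) ≡ u′ ∘ₚ c′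
    translate = begin
      ((u′ ∘ₚ u⁻¹) ∘ₚ (u ∘ₚ c)) ∘ₚ (c⁻¹ ∘ₚ c′)  ≡⟨ cong (_∘ₚ (c⁻¹ ∘ₚ c′)) (∘ₚ-assoc u′ u⁻¹ (u ∘ₚ c)) ⟩
      (u′ ∘ₚ (u⁻¹ ∘ₚ (u ∘ₚ c))) ∘ₚ (c⁻¹ ∘ₚ c′)
        ≡⟨ cong (λ π → (u′ ∘ₚ π) ∘ₚ (c⁻¹ ∘ₚ c′)) (∘ₚ-inverse-cancelˡ u⁻¹ u u⁻¹∘u≡id c) ⟩
      (u′ ∘ₚ c) ∘ₚ (c⁻¹ ∘ₚ c′)                  ≡⟨ ∘ₚ-assoc u′ c (c⁻¹ ∘ₚ c′) ⟩
      u′ ∘ₚ (c ∘ₚ (c⁻¹ ∘ₚ c′))                  ≡⟨ cong (u′ ∘ₚ_) (∘ₚ-inverse-cancelˡ c c⁻¹ c∘c⁻¹≡id c′) ⟩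
      u′ ∘ₚ c′                                  ∎

  module _ (inv : Perm n → Perm n)
           (inv-UC : ∀ σ → InUC U T σ → InUC U T (inv σ))
           (inv-involutive : ∀ σ → InUC U T σ → inv (inv σ) ≡ σ)
           (inv-row : ∀ σ → InUC U T σ →
              ∃ λ ρ → inR T ρ ≡ true × ρ ∘ₚ ρ ≡ idₚ × sgn ρ ≡ -1ℤ × inv σ ≡ σ ∘ₚ ρ)
           where

    -- inv is only constrained on UC; outside UC the multiplicity vanishes, so those σ stay fixed.
    pairing : Perm n → Perm n
    pairing σ with multiplicity σ ≟ 0ℤ
    ... | yes _ = σ
    ... | no  _ = inv σ

    pairing-cases : (σ : Perm n) → (multiplicity σ ≡ 0ℤ × pairing σ ≡ σ)
                                 ⊎ (¬ multiplicity σ ≡ 0ℤ × InUC U T σ × pairing σ ≡ inv σ)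
    pairing-cases σ with multiplicity σ ≟ 0ℤ
    ... | yes mult≡0 = inj₁ (mult≡0 , refl)
    ... | no  mult≢0 = inj₂ (mult≢0 , multiplicity≢0⇒InUC σ mult≢0 , refl)

    multiplicity-inv : (σ : Perm n) → InUC U T σ → multiplicity (inv σ) ≡ multiplicity σ
    multiplicity-inv σ σ∈UC = multiplicity-invariant σ∈UC (inv-UC σ σ∈UC)

    pairing-involutive : (σ : Perm n) → pairing (pairing σ) ≡ σ
    pairing-involutive σ with pairing-cases σ
    ... | inj₁ (_ , pσ≡σ) = trans (cong pairing pσ≡σ) pσ≡σ
    ... | inj₂ (mult≢0 , σ∈UC , pσ≡invσ) with pairing-cases (inv σ)
    ...   | inj₁ (mult-invσ≡0 , _) = ⊥-elim (mult≢0 (trans (sym (multiplicity-inv σ σ∈UC)) mult-invσ≡0))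
    ...   | inj₂ (_ , _ , p-invσ≡inv-invσ) =
      trans (cong pairing pσ≡invσ) (trans p-invσ≡inv-invσ (inv-involutive σ σ∈UC))

    pairing-∈ : ∀ {σ} → σ ∈ allPerms n → pairing σ ∈ allPerms n
    pairing-∈ {σ} σ∈ with pairing-cases σ
    ... | inj₁ (_ , pσ≡σ) = subst (_∈ allPerms n) (sym pσ≡σ) σ∈
    ... | inj₂ (_ , σ∈UC , pσ≡invσ) = subst (_∈ allPerms n) (sym pσ≡invσ)
      (∈-allPerms (inv σ) (injective⇒isPerm (inv σ) (InUC-injective (inv-UC σ σ∈UC))))

    pairing-antisymmetric : ∀ {σ} → σ ∈ allPerms n →
      multiplicity (pairing σ) * weight (pairing σ) ≡ - (multiplicity σ * weight σ)
    pairing-antisymmetric {σ} _ with pairing-cases σ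
    ... | inj₁ (mult≡0 , pσ≡σ) =
      trans (cong (λ π → multiplicity π * weight π) pσ≡σ) (trans term≡0 (cong -_ (sym term≡0)))
      where term≡0 = trans (cong (_* weight σ) mult≡0) (ℤ.*-zeroˡ (weight σ))
    ... | inj₂ (_ , σ∈UC , pσ≡invσ) with inv-row σ σ∈UC
    ...   | ρ , Rρ , _ , sgnρ≡-1 , invσ≡σρ = begin
      multiplicity (pairing σ) * weight (pairing σ)  ≡⟨ cong (λ π → multiplicity π * weight π) pσ≡invσ ⟩
      multiplicity (inv σ) * weight (inv σ)          ≡⟨ cong₂ _*_ (multiplicity-inv σ σ∈UC) (cong weight invσ≡σρ) ⟩
      multiplicity σ * weight (σ ∘ₚ ρ)
        ≡⟨ cong (multiplicity σ *_) (weight-∘ₚ-odd σ ρ (InUC-injective σ∈UC) Rρ sgnρ≡-1) ⟩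
      multiplicity σ * - weight σ                    ≡⟨ ℤ.neg-distribʳ-* (multiplicity σ) (weight σ) ⟨
      - (multiplicity σ * weight σ)                  ∎
      where open ≡-Reasoning

    ∑multiplicity*weight≡0 : ∑[ σ ∈ allPerms n ] (multiplicity σ * weight σ) ≡ 0ℤ
    ∑multiplicity*weight≡0 = ∑-antisymmetric-involution (allPerms-unique n) pairing pairing-involutive pairing-∈
      (λ σ → multiplicity σ * weight σ) pairing-antisymmetric

lemma3p13 : (n : ℕ) (la mu : List ℕ) → IsPartitionOf n la → IsPartitionOf n mu →
    (S : List (List ℕ)) → IsSSYT la mu S →
    (T : List (List (Fin n))) → IsTab n la T →
    (U : Perm n → Bool) → IsSubgroup U →
    (inv : Perm n → Perm n) →
    (∀ σ → InUC U T σ → InUC U T (inv σ)) →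
    (∀ σ → InUC U T σ → inv (inv σ) ≡ σ) →
    (∀ σ → InUC U T σ → ∃ λ ρ → inR T ρ ≡ true × ρ ∘ₚ ρ ≡ idₚ × sgn ρ ≡ -1ℤ × inv σ ≡ σ ∘ₚ ρ) →
    IsZeroPoly (alphaF U T S)
lemma3p13 n _ _ _ _ S _ T _ U U-subgroup inv inv-UC inv-involutive inv-row m = begin
  coeff (alphaF U T S) m                                 ≡⟨ coeff-alphaF ⟩
  ∑[ τ ∈ U.members ] ∑[ γ ∈ C.members ] weight (τ ∘ₚ γ)  ≡⟨ ∑UC≡∑multiplicity ⟩
  ∑[ σ ∈ allPerms n ] (multiplicity σ * weight σ)        ≡⟨ ∑multiplicity*weight≡0 inv inv-UC inv-involutive inv-row ⟩
  0ℤ                                                     ∎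
  where
  open ≡-Reasoning
  open Cancellation T S U-subgroup m
  open IntegerSums using (∑)
  open import Data.Integer using (0ℤ; _*_)
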